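{- Let $\varepsilon>0$ and let $k$ and $n$ be positive integers. If $n>\left(\frac{2}{\varepsilon}\right)^{S(k)^2}$, then \[ n-n^{1/S'(k)}\le g_*(k,n) \le n-(1-\varepsilon)\, n^{1/S(k)}. \]
   Context: For a positive integer $m$, $[m]=\{1,\dots,m\}$ and $[2,m]=\{2,\dots,m\}$. Integers $a,b,c$ (not necessarily distinct) form a product Schur triple if $ab=c$. The Schur number $S(k)$ is the minimum $m\in\mathbb{N}$ such that every $k$-colouring of $[m]$ contains a monochromatic solution of $a+b=c$ (with $a,b,c\in[m]$ not necessarily distinct). The double-sum Schur number $S'(k)$ is the minimum $m\in\mathbb{N}$ such that every $k$-colouring of $[m]$ contains a monochromatic solution of $a+b=c$ or of $a+b=c-1$. $g_*(k,n)$ denotes the largest size of a set $A\subseteq[2,n]$ that admits a $k$-colouring with no monochromatic product Schur triple (i.e. $A$ can be partitioned into $k$ sets none of which contains $a,b,c$ with $ab=c$).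
   Formalization: The parameter ε ranges over the positive rationals. -}

module Defs where

open import Data.Nat using (ℕ; zero; suc; _+_; _*_; _∸_; _^_; _≤_; _<_)
open import Data.Fin using (Fin)
open import Data.Maybe using (Maybe; just; nothing)
open import Data.Product using (_×_; ∃; ∃-syntax; Σ-syntax)
open import Relation.Binary.PropositionalEquality using (_≡_; _≢_)
open import Relation.Nullary using (¬_)
open import Data.Sum using (_⊎_)

-- A k-colouring of [m] is represented by a function ℕ → Fin k
-- (only its values on [m] = {1,…,m} matter).

MonoSchur : (k m : ℕ) → (ℕ → Fin k) → Set
MonoSchur k m col =
  ∃[ a ] ∃[ b ] (1 ≤ a × 1 ≤ b × a + b ≤ m ×
                 col a ≡ col b × col b ≡ col (a + b))

MonoSchur1 : (k m : ℕ) → (ℕ → Fin k) → Set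
MonoSchur1 k m col =
  ∃[ a ] ∃[ b ] (1 ≤ a × 1 ≤ b × suc (a + b) ≤ m ×
                 col a ≡ col b × col b ≡ col (suc (a + b)))

AllSchur : (k m : ℕ) → Set
AllSchur k m = (col : ℕ → Fin k) → MonoSchur k m col

AllSchur' : (k m : ℕ) → Set
AllSchur' k m = (col : ℕ → Fin k) → (MonoSchur k m col ⊎ MonoSchur1 k m col)

IsSchurNumber : (k s : ℕ) → Set
IsSchurNumber k s = AllSchur k s × ((m : ℕ) → m < s → ¬ AllSchur k m)

IsDoubleSchurNumber : (k s : ℕ) → Set
IsDoubleSchurNumber k s = AllSchur' k s × ((m : ℕ) → m < s → ¬ AllSchur' k m)

-- A partial colouring f : ℕ → Maybe (Fin k) encodes a set A ⊆ [2,n]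
-- (A = {x ∈ [2,n] : f x ≠ nothing}) together with a k-colouring of A.
ProductFree : (k n : ℕ) → (ℕ → Maybe (Fin k)) → Set
ProductFree k n f =
  (a b : ℕ) (i : Fin k) → 2 ≤ a → 2 ≤ b → a * b ≤ n →
  f a ≡ just i → f b ≡ just i → f (a * b) ≢ just i

private
  ind : {A : Set} → Maybe A → ℕ
  ind nothing = 0
  ind (just _) = 1

size : {k : ℕ} → (ℕ → Maybe (Fin k)) → ℕ → ℕ
size f zero = 0
size f (suc zero) = 0
size f (suc (suc m)) = size f (suc m) + ind (f (suc (suc m)))

IsGStar : (k n g : ℕ) → Set
IsGStar k n g =
  (∃[ f ] (ProductFree k n f × size f n ≡ g)) ×
  ((f : ℕ → Maybe (Fin k)) → ProductFree k n f → size f n ≤ g)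

-- Write ε = p/q.  Lower bound: let t = S'(k) and let χ colour [t-1] with no
-- monochromatic a + b = c or a + b + 1 = c.  Put x ∈ [2,n] into A when x^t > n and
-- give it colour χ(j), where n^j < x^t ≤ n^(j+1).  The exponent j of a product ab
-- is j_a + j_b or j_a + j_b + 1, so a monochromatic product triple would yield a
-- forbidden sum triple; and every x missing from A is at most n^(1/t).
-- Upper bound: let s = S(k), m = ⌊n^(1/s)⌋ and L = ⌊m^((s-1)/s)⌋.  For x ∈ (L,m],
-- colouring i ∈ [s] by the colour of x^i yields a monochromatic i + j = l, and
-- x^i x^j = x^l, so some power x^i with 1 ≤ i ≤ s is missing from A.  These powers
-- are distinct for distinct x, hence n - |A| ≥ m + 1 - L, and L ≤ ε(m + 1) as soon
-- as (2/ε)^(s²) < n.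

{-# OPTIONS --safe #-}
module Submission where

open import Defs
open import Data.Nat using (ℕ; _*_; _∸_; _^_; _≤_; _<_)
open import Data.Product using (_×_)

open import Data.Nat
  using (zero; suc; _+_; z≤n; s≤s; s≤s⁻¹; z<s; NonZero; >-nonZero; _≟_; _≤?_; _<?_)
open import Data.Nat.Properties
open import Data.Product using (∃-syntax; _,_)
open import Data.Empty using (⊥)
open import Data.Sum as Sum using (_⊎_; inj₁; inj₂; [_,_]′)
open import Data.Fin using (Fin; zero; suc; toℕ; fromℕ<; finToFun; funToFin)
open import Data.Fin.Properties using (¬∀⟶∃¬; finToFun-funToFin; toℕ-fromℕ<) renaming (_≟_ to _≟ᶠ_)
open import Data.Maybe using (Maybe; just; nothing; fromMaybe)
open import Function using (_∘_)
open import Relation.Nullary using (¬_; Dec; yes; no; contradiction)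
open import Relation.Nullary.Decidable using (map′; _×-dec_; _⊎-dec_)
open import Relation.Unary using (Pred; Decidable)
open import Relation.Binary.PropositionalEquality
open import Relation.Binary.Definitions using (tri<; tri≈; tri>)

^-distribʳ-* : ∀ m n o → (m * n) ^ o ≡ m ^ o * n ^ o
^-distribʳ-* m n zero = refl
^-distribʳ-* m n (suc o) = begin
  m * n * (m * n) ^ o       ≡⟨ cong (m * n *_) (^-distribʳ-* m n o) ⟩
  m * n * (m ^ o * n ^ o)   ≡⟨ [m*n]*[o*p]≡[m*o]*[n*p] m n (m ^ o) (n ^ o) ⟩
  m * m ^ o * (n * n ^ o)   ∎
  where open ≡-Reasoning

^-cancelˡ-< : ∀ {m o} n → m ^ n < o ^ n → m < o
^-cancelˡ-< {m} {o} n mⁿ<oⁿ with m <? o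
... | yes m<o = m<o
... | no m≮o = contradiction (^-monoˡ-≤ n (≮⇒≥ m≮o)) (<⇒≱ mⁿ<oⁿ)

^-cancelˡ-≤ : ∀ {m o} n .{{_ : NonZero n}} → m ^ n ≤ o ^ n → m ≤ o
^-cancelˡ-≤ {m} {o} n mⁿ≤oⁿ with m ≤? o
... | yes m≤o = m≤o
... | no m≰o = contradiction mⁿ≤oⁿ (<⇒≱ (^-monoˡ-< n (≰⇒> m≰o)))

^-cancelʳ-< : ∀ m .{{_ : NonZero m}} {n o} → m ^ n < m ^ o → n < o
^-cancelʳ-< m {n} {o} mⁿ<mᵒ with n <? o
... | yes n<o = n<o
... | no n≮o = contradiction (^-monoʳ-≤ m (≮⇒≥ n≮o)) (<⇒≱ mⁿ<mᵒ)

m≤m^n : ∀ m n .{{_ : NonZero n}} → m ≤ m ^ n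
m≤m^n zero (suc n) = z≤n
m≤m^n m@(suc _) (suc n) = m≤m*n m (m ^ n) {{m^n≢0 m n}}

∸-suc-≤ : ∀ m n → suc m ∸ n ≤ suc (m ∸ n)
∸-suc-≤ m n = m≤n+o⇒m∸n≤o (suc m) n (subst (suc m ≤_) (sym (+-suc n (m ∸ n))) (s≤s (m≤n+m∸n m n)))

∸-≤-swap : ∀ {m n o} → m ∸ n ≤ o → m ∸ o ≤ n
∸-≤-swap {m} {n} {o} m∸n≤o =
  m≤n+o⇒m∸n≤o m o (subst (m ≤_) (+-comm n o) (≤-trans (m≤n+m∸n m n) (+-monoʳ-≤ n m∸n≤o)))

module _ {p} {P : Pred ℕ p} (P? : Decidable P) where

  greatest : ℕ → ℕ
  greatest zero = zero
  greatest (suc b) with P? (suc b)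
  ... | yes _ = suc b
  ... | no _ = greatest b

  greatest-≤ : ∀ b → greatest b ≤ b
  greatest-≤ zero = z≤n
  greatest-≤ (suc b) with P? (suc b)
  ... | yes _ = ≤-refl
  ... | no _ = m≤n⇒m≤1+n (greatest-≤ b)

  greatest-maximal : ∀ {b x} → x ≤ b → P x → x ≤ greatest b
  greatest-maximal {zero} x≤b _ = x≤b
  greatest-maximal {suc b} x≤b Px with P? (suc b) | m≤n⇒m<n∨m≡n x≤b
  ... | yes _ | _ = x≤b
  ... | no _ | inj₁ x<b = greatest-maximal (s≤s⁻¹ x<b) Px
  ... | no ¬P | inj₂ refl = contradiction Px ¬P

  greatest-satisfies : ∀ {b x} → x ≤ b → P x → P (greatest b)
  greatest-satisfies {zero} z≤n Px = Px
  greatest-satisfies {suc b} x≤b Px with P? (suc b) | m≤n⇒m<n∨m≡n x≤b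
  ... | yes P[1+b] | _ = P[1+b]
  ... | no _ | inj₁ x<b = greatest-satisfies (s≤s⁻¹ x<b) Px
  ... | no ¬P | inj₂ refl = contradiction Px ¬P

root : ℕ → ℕ → ℕ
root t n = greatest (λ z → z ^ t ≤? n) n

module _ (t : ℕ) .{{_ : NonZero t}} {n : ℕ} where

  root-^-≤ : 1 ≤ n → root t n ^ t ≤ n
  root-^-≤ 1≤n = greatest-satisfies (λ z → z ^ t ≤? n) 1≤n (subst (_≤ n) (sym (^-zeroˡ t)) 1≤n)

  ≤-root : ∀ {z} → z ^ t ≤ n → z ≤ root t n
  ≤-root zᵗ≤n = greatest-maximal (λ z → z ^ t ≤? n) (≤-trans (m≤m^n _ t) zᵗ≤n) zᵗ≤n

  root-pos : 1 ≤ n → 1 ≤ root t n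
  root-pos 1≤n = ≤-root (subst (_≤ n) (sym (^-zeroˡ t)) 1≤n)

  <-suc-root-^ : n < suc (root t n) ^ t
  <-suc-root-^ with n <? suc (root t n) ^ t
  ... | yes n<[1+r]ᵗ = n<[1+r]ᵗ
  ... | no n≮[1+r]ᵗ = contradiction (≤-root (≮⇒≥ n≮[1+r]ᵗ)) (1+n≰n)

monoSchur⇒2≤ : ∀ {k m c} → MonoSchur k m c → 2 ≤ m
monoSchur⇒2≤ (_ , _ , 1≤a , 1≤b , a+b≤m , _) = ≤-trans (+-mono-≤ 1≤a 1≤b) a+b≤m

monoSchur1⇒2≤ : ∀ {k m c} → MonoSchur1 k m c → 2 ≤ m
monoSchur1⇒2≤ (_ , _ , 1≤a , 1≤b , 1+a+b≤m , _) =
  ≤-trans (+-mono-≤ 1≤a 1≤b) (≤-trans (n≤1+n _) 1+a+b≤m)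

allSchur⇒2≤ : ∀ {k m} → AllSchur (suc k) m → 2 ≤ m
allSchur⇒2≤ all = monoSchur⇒2≤ (all (λ _ → zero))

allSchur'⇒2≤ : ∀ {k m} → AllSchur' (suc k) m → 2 ≤ m
allSchur'⇒2≤ all = [ monoSchur⇒2≤ , monoSchur1⇒2≤ ]′ (all (λ _ → zero))

bounded-∃? : ∀ {p} {P : Pred ℕ p} → Decidable P → ∀ b → (∀ {x} → P x → x ≤ b) → Dec (∃[ x ] P x)
bounded-∃? P? b bound = map′ (λ (x , _ , Px) → x , Px) (λ (x , Px) → x , s≤s (bound Px) , Px)
  (anyUpTo? P? (suc b))

module _ {k m : ℕ} (c : ℕ → Fin k) where

  monoSchur? : Dec (MonoSchur k m c)
  monoSchur? =
    bounded-∃? (λ a → bounded-∃? (triple? a) m λ (_ , _ , a+b≤m , _) → ≤-trans (m≤n+m _ a) a+b≤m) m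
      λ (b , _ , _ , a+b≤m , _) → ≤-trans (m≤m+n _ b) a+b≤m
    where
    triple? : ∀ a b → Dec (1 ≤ a × 1 ≤ b × a + b ≤ m × c a ≡ c b × c b ≡ c (a + b))
    triple? a b = 1 ≤? a ×-dec 1 ≤? b ×-dec a + b ≤? m ×-dec c a ≟ᶠ c b ×-dec c b ≟ᶠ c (a + b)

  monoSchur1? : Dec (MonoSchur1 k m c)
  monoSchur1? =
    bounded-∃? (λ a → bounded-∃? (triple? a) m λ (_ , _ , 1+a+b≤m , _) → ≤-trans (m≤n+m _ (suc a)) 1+a+b≤m) m
      λ (b , _ , _ , 1+a+b≤m , _) → ≤-trans (m≤m+n _ b) (≤-trans (n≤1+n _) 1+a+b≤m)
    where
    triple? : ∀ a b → Dec (1 ≤ a × 1 ≤ b × suc (a + b) ≤ m × c a ≡ c b × c b ≡ c (suc (a + b)))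
    triple? a b = 1 ≤? a ×-dec 1 ≤? b ×-dec suc (a + b) ≤? m ×-dec c a ≟ᶠ c b ×-dec c b ≟ᶠ c (suc (a + b))

module _ {k m : ℕ} {c c′ : ℕ → Fin k} (c≗c′ : ∀ {x} → 1 ≤ x → x ≤ m → c x ≡ c′ x) where

  monoSchur-cong : MonoSchur k m c → MonoSchur k m c′
  monoSchur-cong (a , b , 1≤a , 1≤b , a+b≤m , ca≡cb , cb≡cab) =
    a , b , 1≤a , 1≤b , a+b≤m ,
    trans (sym (c≗c′ 1≤a a≤m)) (trans ca≡cb (c≗c′ 1≤b b≤m)) ,
    trans (sym (c≗c′ 1≤b b≤m)) (trans cb≡cab (c≗c′ (≤-trans 1≤a (m≤m+n a b)) a+b≤m))
    where
    a≤m = ≤-trans (m≤m+n a b) a+b≤m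
    b≤m = ≤-trans (m≤n+m b a) a+b≤m

  monoSchur1-cong : MonoSchur1 k m c → MonoSchur1 k m c′
  monoSchur1-cong (a , b , 1≤a , 1≤b , 1+a+b≤m , ca≡cb , cb≡c1ab) =
    a , b , 1≤a , 1≤b , 1+a+b≤m ,
    trans (sym (c≗c′ 1≤a a≤m)) (trans ca≡cb (c≗c′ 1≤b b≤m)) ,
    trans (sym (c≗c′ 1≤b b≤m)) (trans cb≡c1ab (c≗c′ (s≤s z≤n) 1+a+b≤m))
    where
    a≤m = ≤-trans (m≤m+n a b) (≤-trans (n≤1+n _) 1+a+b≤m)
    b≤m = ≤-trans (m≤n+m b (suc a)) 1+a+b≤m

-- The code i ∈ Fin ((k+1)^m) colours x ∈ [m] by its (x-1)-th digit; values off [m] are irrelevant.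
colouringOf : ∀ {k} m → Fin (suc k ^ m) → ℕ → Fin (suc k)
colouringOf m i zero = zero
colouringOf {k} m i (suc x) with x <? m
... | yes x<m = finToFun {suc k} {m} i (fromℕ< x<m)
... | no _ = zero

codeOf : ∀ {k} m → (ℕ → Fin (suc k)) → Fin (suc k ^ m)
codeOf m c = funToFin {m} (c ∘ suc ∘ toℕ)

colouringOf-codeOf : ∀ {k} m (c : ℕ → Fin (suc k)) {x} → 1 ≤ x → x ≤ m →
  colouringOf m (codeOf m c) x ≡ c x
colouringOf-codeOf m c {suc x} _ 1+x≤m with x <? m
... | yes x<m = trans (finToFun-funToFin (c ∘ suc ∘ toℕ) (fromℕ< x<m)) (cong (c ∘ suc) (toℕ-fromℕ< x<m))
... | no x≮m = contradiction 1+x≤m x≮m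

schurFree-colouring : ∀ {k m} → ¬ AllSchur' (suc k) m →
  ∃[ c ] ¬ MonoSchur (suc k) m c × ¬ MonoSchur1 (suc k) m c
schurFree-colouring {k} {m} ¬all =
  let i , ¬mono = ¬∀⟶∃¬ (suc k ^ m) Mono Mono? every-code-mono
  in colouringOf m i , ¬mono ∘ inj₁ , ¬mono ∘ inj₂
  where
  Mono : Fin (suc k ^ m) → Set
  Mono i = MonoSchur (suc k) m (colouringOf m i) ⊎ MonoSchur1 (suc k) m (colouringOf m i)
  Mono? : ∀ i → Dec (Mono i)
  Mono? i = monoSchur? _ ⊎-dec monoSchur1? _
  every-code-mono : ¬ (∀ i → Mono i)
  every-code-mono all = ¬all λ c →
    Sum.map (monoSchur-cong (colouringOf-codeOf m c)) (monoSchur1-cong (colouringOf-codeOf m c))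
      (all (codeOf m c))

module _ {k : ℕ} where

  Gap : (ℕ → Maybe (Fin k)) → ℕ → ℕ → Set
  Gap f n y = 2 ≤ y × y ≤ n × f y ≡ nothing

  size-≤ : ∀ (f : ℕ → Maybe (Fin k)) n → size f n ≤ n ∸ 1
  size-≤ f zero = z≤n
  size-≤ f (suc zero) = z≤n
  size-≤ f (suc (suc m)) with size-≤ f (suc m) | f (suc (suc m))
  ... | size≤m | just _ = subst (_≤ suc m) (+-comm 1 _) (s≤s size≤m)
  ... | size≤m | nothing = subst (_≤ suc m) (sym (+-identityʳ _)) (m≤n⇒m≤1+n size≤m)

  size-cong : ∀ {f g : ℕ → Maybe (Fin k)} n → (∀ {z} → 2 ≤ z → z ≤ n → f z ≡ g z) → size f n ≡ size g n
  size-cong zero _ = refl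
  size-cong (suc zero) _ = refl
  size-cong (suc (suc m)) f≗g
    rewrite size-cong (suc m) (λ 2≤z z≤m → f≗g 2≤z (m≤n⇒m≤1+n z≤m)) | f≗g (s≤s (s≤s z≤n)) ≤-refl = refl

  fill : ℕ → Fin k → (ℕ → Maybe (Fin k)) → ℕ → Maybe (Fin k)
  fill y c f z with z ≟ y
  ... | yes _ = just c
  ... | no _ = f z

  fill-at : ∀ y c f → fill y c f y ≡ just c
  fill-at y c f with y ≟ y
  ... | yes _ = refl
  ... | no y≢y = contradiction refl y≢y

  fill-elsewhere : ∀ {y z} c f → z ≢ y → fill y c f z ≡ f z
  fill-elsewhere {y} {z} c f z≢y with z ≟ y
  ... | yes z≡y = contradiction z≡y z≢y
  ... | no _ = refl

  size-fill : ∀ {f y} c n → Gap f n y → size (fill y c f) n ≡ suc (size f n)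
  size-fill c zero (2≤y , y≤0 , _) = contradiction (≤-trans 2≤y y≤0) λ ()
  size-fill c (suc zero) (2≤y , y≤1 , _) = contradiction (≤-trans 2≤y y≤1) 1+n≰n
  size-fill {f} {y} c (suc (suc m)) (2≤y , y≤n , fy≡nothing)
    with y ≟ suc (suc m) | (λ y≤1+m → size-fill c (suc m) (2≤y , y≤1+m , fy≡nothing))
  ... | yes refl | _ rewrite fill-at y c f | fy≡nothing
        | size-cong (suc m) (λ _ z≤m → fill-elsewhere c f (<⇒≢ (s≤s z≤m))) =
    trans (+-comm _ 1) (cong suc (sym (+-identityʳ _)))
  ... | no y≢n | ih rewrite fill-elsewhere c f (y≢n ∘ sym) = cong (_+ _) (ih (s≤s⁻¹ (≤∧≢⇒< y≤n y≢n)))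

bounded-gaps⇒∸≤size : ∀ {k r} {f : ℕ → Maybe (Fin k)} n → 1 ≤ r → (∀ {z} → Gap f n z → z ≤ r) →
  n ∸ r ≤ size f n
bounded-gaps⇒∸≤size {r = r} zero _ _ = ≤-reflexive (0∸n≡0 r)
bounded-gaps⇒∸≤size (suc zero) 1≤r _ = ≤-reflexive (m≤n⇒m∸n≡0 1≤r)
bounded-gaps⇒∸≤size {r = r} {f} (suc (suc m)) 1≤r gap≤r
  with bounded-gaps⇒∸≤size (suc m) 1≤r (λ (2≤z , z≤1+m , fz) → gap≤r (2≤z , m≤n⇒m≤1+n z≤1+m , fz))
     | f (suc (suc m)) in fn
... | ih | nothing = ≤-trans (≤-reflexive (m≤n⇒m∸n≡0 (gap≤r (s≤s (s≤s z≤n) , ≤-refl , fn)))) z≤n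
... | ih | just _ = ≤-trans (∸-suc-≤ (suc m) r) (subst (suc (suc m ∸ r) ≤_) (+-comm 1 _) (s≤s ih))

injective-gaps⇒m∸L+size≤n∸1 : ∀ {k n L} (R : ℕ → ℕ → Set) U (f : ℕ → Maybe (Fin (suc k))) →
  (∀ {x x′ y} → L < x → x ≤ U → L < x′ → x′ ≤ U → R x y → R x′ y → x ≡ x′) →
  (∀ {x} → L < x → x ≤ U → ∃[ y ] R x y × Gap f n y) →
  U ∸ L + size f n ≤ n ∸ 1
injective-gaps⇒m∸L+size≤n∸1 {n = n} {L} R zero f _ _ rewrite 0∸n≡0 L = size-≤ f n
injective-gaps⇒m∸L+size≤n∸1 {n = n} {L} R (suc U) f injective gaps with L <? suc U
... | no L≮1+U rewrite m≤n⇒m∸n≡0 (≮⇒≥ L≮1+U) = size-≤ f n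
... | yes L<1+U with gaps L<1+U ≤-refl
... | y , Rxy , gap = begin
  suc U ∸ L + size f n            ≡⟨ cong (_+ size f n) (+-∸-assoc 1 (s≤s⁻¹ L<1+U)) ⟩
  suc (U ∸ L) + size f n          ≡⟨ sym (+-suc (U ∸ L) (size f n)) ⟩
  U ∸ L + suc (size f n)          ≡⟨ cong (U ∸ L +_) (sym (size-fill zero n gap)) ⟩
  U ∸ L + size (fill y zero f) n  ≤⟨ injective-gaps⇒m∸L+size≤n∸1 R U (fill y zero f) injective′ gaps′ ⟩
  n ∸ 1                           ∎
  where
  open ≤-Reasoning
  injective′ : ∀ {x x′ y} → L < x → x ≤ U → L < x′ → x′ ≤ U → R x y → R x′ y → x ≡ x′
  injective′ Lx x≤U Lx′ x′≤U = injective Lx (m≤n⇒m≤1+n x≤U) Lx′ (m≤n⇒m≤1+n x′≤U)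
  gaps′ : ∀ {x} → L < x → x ≤ U → ∃[ y′ ] R x y′ × Gap (fill y zero f) n y′
  gaps′ {x} Lx x≤U with gaps Lx (m≤n⇒m≤1+n x≤U)
  ... | y′ , Rxy′ , 2≤y′ , y′≤n , fy′ = y′ , Rxy′ , 2≤y′ , y′≤n , trans (fill-elsewhere zero f y′≢y) fy′
    where
    y′≢y : y′ ≢ y
    y′≢y refl = <⇒≢ (s≤s x≤U) (injective Lx (m≤n⇒m≤1+n x≤U) L<1+U ≤-refl Rxy′ Rxy)

exponent-window-* : ∀ {n X Y} .{{_ : NonZero n}} i j l →
  n ^ i < X → X ≤ n ^ suc i → n ^ j < Y → Y ≤ n ^ suc j →
  n ^ l < X * Y → X * Y ≤ n ^ suc l → l ≡ i + j ⊎ l ≡ suc (i + j)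
exponent-window-* {n} {X} {Y} i j l nⁱ<X X≤n¹⁺ⁱ nʲ<Y Y≤n¹⁺ʲ nˡ<XY XY≤n¹⁺ˡ =
  Sum.map₁ (λ l<1+i+j → ≤-antisym (s≤s⁻¹ l<1+i+j) (s≤s⁻¹ i+j<1+l)) (m≤n⇒m<n∨m≡n (s≤s⁻¹ l<2+i+j))
  where
  open ≤-Reasoning
  i+j<1+l : i + j < suc l
  i+j<1+l = ^-cancelʳ-< n (begin-strict
    n ^ (i + j)  ≡⟨ ^-distribˡ-+-* n i j ⟩
    n ^ i * n ^ j <⟨ *-mono-< nⁱ<X nʲ<Y ⟩
    X * Y         ≤⟨ XY≤n¹⁺ˡ ⟩
    n ^ suc l     ∎)
  l<2+i+j : l < suc (suc (i + j))
  l<2+i+j = ^-cancelʳ-< n (begin-strict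
    n ^ l                   <⟨ nˡ<XY ⟩
    X * Y                   ≤⟨ *-mono-≤ X≤n¹⁺ⁱ Y≤n¹⁺ʲ ⟩
    n ^ suc i * n ^ suc j   ≡⟨ ^-distribˡ-+-* n (suc i) (suc j) ⟨
    n ^ (suc i + suc j)     ≡⟨ cong (λ e → n ^ suc e) (+-suc i j) ⟩
    n ^ suc (suc (i + j))   ∎)

module LowerBound {k M n : ℕ} (1≤M : 1 ≤ M) (1≤n : 1 ≤ n) (c : ℕ → Fin k)
  (no-sum : ¬ MonoSchur k M c) (no-sum1 : ¬ MonoSchur1 k M c) where

  instance
    n≢0 : NonZero n
    n≢0 = >-nonZero 1≤n

  t : ℕ
  t = suc M

  level : ℕ → ℕ
  level x = greatest (λ j → n ^ j <? x ^ t) M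

  colouring : ℕ → Maybe (Fin k)
  colouring x with n <? x ^ t
  ... | yes _ = just (c (level x))
  ... | no _ = nothing

  colouring-just : ∀ {x col} → colouring x ≡ just col → n < x ^ t × c (level x) ≡ col
  colouring-just {x} eq with n <? x ^ t | eq
  ... | yes n<xᵗ | refl = n<xᵗ , refl

  colouring-nothing : ∀ {x} → colouring x ≡ nothing → x ^ t ≤ n
  colouring-nothing {x} eq with n <? x ^ t | eq
  ... | no n≮xᵗ | refl = ≮⇒≥ n≮xᵗ

  module _ {x} (x≤n : x ≤ n) (n<xᵗ : n < x ^ t) where

    private
      n¹<xᵗ : n ^ 1 < x ^ t
      n¹<xᵗ = subst (_< x ^ t) (sym (*-identityʳ n)) n<xᵗ

    level-pos : 1 ≤ level x
    level-pos = greatest-maximal (λ j → n ^ j <? x ^ t) 1≤M n¹<xᵗ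

    level-≤ : level x ≤ M
    level-≤ = greatest-≤ (λ j → n ^ j <? x ^ t) M

    level-lower : n ^ level x < x ^ t
    level-lower = greatest-satisfies (λ j → n ^ j <? x ^ t) 1≤M n¹<xᵗ

    level-upper : x ^ t ≤ n ^ suc (level x)
    level-upper with suc (level x) ≤? M
    ... | yes 1+l≤M = ≮⇒≥ λ nˡ⁺¹<xᵗ → 1+n≰n (greatest-maximal (λ j → n ^ j <? x ^ t) 1+l≤M nˡ⁺¹<xᵗ)
    ... | no 1+l≰M rewrite ≤-antisym level-≤ (s≤s⁻¹ (≰⇒> 1+l≰M)) = ^-monoˡ-≤ t x≤n

  level-* : ∀ {a b} → a ≤ n → b ≤ n → a * b ≤ n → n < a ^ t → n < b ^ t → n < (a * b) ^ t →
    level (a * b) ≡ level a + level b ⊎ level (a * b) ≡ suc (level a + level b)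
  level-* {a} {b} a≤n b≤n ab≤n n<aᵗ n<bᵗ n<abᵗ =
    exponent-window-* (level a) (level b) (level (a * b))
                      (level-lower a≤n n<aᵗ) (level-upper a≤n n<aᵗ)
                      (level-lower b≤n n<bᵗ) (level-upper b≤n n<bᵗ)
                      (subst (n ^ level (a * b) <_) (^-distribʳ-* a b t) (level-lower ab≤n n<abᵗ))
                      (subst (_≤ n ^ suc (level (a * b))) (^-distribʳ-* a b t) (level-upper ab≤n n<abᵗ))

  colouring-productFree : ProductFree k n colouring
  colouring-productFree a b col 2≤a 2≤b ab≤n fa fb fab
    with colouring-just fa | colouring-just fb | colouring-just fab
  ... | n<aᵗ , ca | n<bᵗ , cb | n<abᵗ , cab = monochromatic (level-* a≤n b≤n ab≤n n<aᵗ n<bᵗ n<abᵗ)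
    where
    a≤n = ≤-trans (m≤m*n a b {{>-nonZero (<-trans z<s 2≤b)}}) ab≤n
    b≤n = ≤-trans (m≤n*m b a {{>-nonZero (<-trans z<s 2≤a)}}) ab≤n
    monochromatic : level (a * b) ≡ level a + level b ⊎ level (a * b) ≡ suc (level a + level b) → ⊥
    monochromatic (inj₁ lab≡la+lb) = no-sum (level a , level b , level-pos a≤n n<aᵗ , level-pos b≤n n<bᵗ ,
      subst (_≤ M) lab≡la+lb (level-≤ ab≤n n<abᵗ) ,
      trans ca (sym cb) , trans cb (trans (sym cab) (cong c lab≡la+lb)))
    monochromatic (inj₂ lab≡1+la+lb) = no-sum1 (level a , level b , level-pos a≤n n<aᵗ , level-pos b≤n n<bᵗ ,
      subst (_≤ M) lab≡1+la+lb (level-≤ ab≤n n<abᵗ) ,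
      trans ca (sym cb) , trans cb (trans (sym cab) (cong c lab≡1+la+lb)))

  gap-≤-root : ∀ {z} → Gap colouring n z → z ≤ root t n
  gap-≤-root (_ , _ , fz) = ≤-root t (colouring-nothing fz)

  lower-bound : ∀ {g} → IsGStar k n g → (n ∸ g) ^ t ≤ n
  lower-bound {g} (_ , maximal) = ≤-trans (^-monoˡ-≤ t (∸-≤-swap {n} {root t n} n∸r≤g)) (root-^-≤ t 1≤n)
    where
    n∸r≤g : n ∸ root t n ≤ g
    n∸r≤g = ≤-trans (bounded-gaps⇒∸≤size n (root-pos t 1≤n) gap-≤-root) (maximal colouring colouring-productFree)

power-gap : ∀ {k n s x} {f : ℕ → Maybe (Fin (suc k))} → ProductFree (suc k) n f → AllSchur (suc k) s →
  2 ≤ x → x ^ s ≤ n → ∃[ i ] 1 ≤ i × i ≤ s × f (x ^ i) ≡ nothing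
power-gap {k} {n} {s} {x} {f} productFree allSchur 2≤x xˢ≤n
  with allSchur (λ j → fromMaybe zero (f (x ^ j)))
... | a , b , 1≤a , 1≤b , a+b≤s , ca≡cb , cb≡cab
  with f (x ^ a) in fa | f (x ^ b) in fb | f (x ^ (a + b)) in fab
... | nothing | _ | _ = a , 1≤a , ≤-trans (m≤m+n a b) a+b≤s , fa
... | just _ | nothing | _ = b , 1≤b , ≤-trans (m≤n+m b a) a+b≤s , fb
... | just _ | just _ | nothing = a + b , ≤-trans 1≤a (m≤m+n a b) , a+b≤s , fab
... | just col | just _ | just _ = contradiction
      (subst (λ z → f z ≡ just col) (^-distribˡ-+-* x a b) (trans fab (cong just (sym (trans ca≡cb cb≡cab)))))
      (productFree (x ^ a) (x ^ b) col (≤-trans 2≤x (m≤m^n x a {{>-nonZero 1≤a}}))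
        (≤-trans 2≤x (m≤m^n x b {{>-nonZero 1≤b}}))
        (≤-trans (≤-reflexive (sym (^-distribˡ-+-* x a b))) (≤-trans (^-monoʳ-≤ x {{x≢0}} a+b≤s) xˢ≤n))
        fa (trans fb (cong just (sym ca≡cb))))
  where
  x≢0 : NonZero x
  x≢0 = >-nonZero (<-trans z<s 2≤x)

^-≢-of-close-bases : ∀ {s₁ x y i j} → 2 ≤ x → x < y → y ^ s₁ < x ^ suc s₁ →
  1 ≤ i → i ≤ suc s₁ → 1 ≤ j → j ≤ suc s₁ → x ^ i ≢ y ^ j
^-≢-of-close-bases {s₁} {x} {y} {i} {j} 2≤x x<y yˢ¹<xˢ 1≤i i≤s 1≤j j≤s xⁱ≡yʲ with i ≤? j
... | yes i≤j = <⇒≢ (<-≤-trans (^-monoˡ-< i {{>-nonZero 1≤i}} x<y) (^-monoʳ-≤ y {{y≢0}} i≤j)) xⁱ≡yʲ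
  where
  y≢0 : NonZero y
  y≢0 = >-nonZero (<-trans z<s (<-trans 2≤x x<y))
... | no i≰j = <⇒≱ s₁<j (s≤s⁻¹ (≤-trans (≰⇒> i≰j) i≤s))
  where
  instance
    x≢0 : NonZero x
    x≢0 = >-nonZero (<-trans z<s 2≤x)
  open ≤-Reasoning
  exponents : i * s₁ < suc s₁ * j
  exponents = ^-cancelʳ-< x (begin-strict
    x ^ (i * s₁)        ≡⟨ ^-*-assoc x i s₁ ⟨
    (x ^ i) ^ s₁        ≡⟨ cong (_^ s₁) xⁱ≡yʲ ⟩
    (y ^ j) ^ s₁        ≡⟨ ^-*-assoc y j s₁ ⟩
    y ^ (j * s₁)        ≡⟨ cong (y ^_) (*-comm j s₁) ⟩
    y ^ (s₁ * j)        ≡⟨ ^-*-assoc y s₁ j ⟨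
    (y ^ s₁) ^ j        <⟨ ^-monoˡ-< j {{>-nonZero 1≤j}} yˢ¹<xˢ ⟩
    (x ^ suc s₁) ^ j    ≡⟨ ^-*-assoc x (suc s₁) j ⟩
    x ^ (suc s₁ * j)    ∎)
  s₁<j : s₁ < j
  s₁<j = +-cancelʳ-< (j * s₁) s₁ j (begin-strict
    suc j * s₁      ≤⟨ *-monoˡ-≤ s₁ (≰⇒> i≰j) ⟩
    i * s₁          <⟨ exponents ⟩
    j + s₁ * j      ≡⟨ cong (j +_) (*-comm s₁ j) ⟩
    j + j * s₁      ∎)

module UpperBound {k n s₁ : ℕ} (1≤n : 1 ≤ n) (allSchur : AllSchur (suc k) (suc s₁))
  {f : ℕ → Maybe (Fin (suc k))} (productFree : ProductFree (suc k) n f) where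

  s : ℕ
  s = suc s₁

  m : ℕ
  m = root s n

  instance
    m≢0 : NonZero m
    m≢0 = >-nonZero (root-pos s 1≤n)

  -- Above L, no two bases share a power with exponent ≤ s.
  L : ℕ
  L = root s (m ^ s₁)

  module _ {x} (L<x : L < x) (x≤m : x ≤ m) where

    2≤x : 2 ≤ x
    2≤x = ≤-trans (s≤s (root-pos s (m^n>0 m s₁))) L<x

    xˢ≤n : x ^ s ≤ n
    xˢ≤n = ≤-trans (^-monoˡ-≤ s x≤m) (root-^-≤ s 1≤n)

    mˢ¹<xˢ : m ^ s₁ < x ^ s
    mˢ¹<xˢ = <-≤-trans (<-suc-root-^ s {m ^ s₁}) (^-monoˡ-≤ s L<x)

  IsPowerOf : ℕ → ℕ → Set
  IsPowerOf x y = ∃[ i ] 1 ≤ i × i ≤ s × y ≡ x ^ i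

  gap-among-powers : ∀ {x} → L < x → x ≤ m → ∃[ y ] IsPowerOf x y × Gap f n y
  gap-among-powers {x} L<x x≤m with power-gap productFree allSchur (2≤x L<x x≤m) (xˢ≤n L<x x≤m)
  ... | i , 1≤i , i≤s , fxⁱ = x ^ i , (i , 1≤i , i≤s , refl) ,
    ≤-trans (2≤x L<x x≤m) (m≤m^n x i {{>-nonZero 1≤i}}) ,
    ≤-trans (^-monoʳ-≤ x {{>-nonZero (<-trans z<s (2≤x L<x x≤m))}} i≤s) (xˢ≤n L<x x≤m) ,
    fxⁱ

  powers-injective : ∀ {x x′ y} → L < x → x ≤ m → L < x′ → x′ ≤ m →
    IsPowerOf x y → IsPowerOf x′ y → x ≡ x′
  powers-injective {x} {x′} L<x x≤m L<x′ x′≤m (i , 1≤i , i≤s , y≡xⁱ) (j , 1≤j , j≤s , y≡x′ʲ)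
    with <-cmp x x′
  ... | tri≈ _ x≡x′ _ = x≡x′
  ... | tri< x<x′ _ _ = contradiction (trans (sym y≡xⁱ) y≡x′ʲ)
    (^-≢-of-close-bases (2≤x L<x x≤m) x<x′ (≤-<-trans (^-monoˡ-≤ s₁ x′≤m) (mˢ¹<xˢ L<x x≤m)) 1≤i i≤s 1≤j j≤s)
  ... | tri> _ _ x′<x = contradiction (trans (sym y≡x′ʲ) y≡xⁱ)
    (^-≢-of-close-bases (2≤x L<x′ x′≤m) x′<x (≤-<-trans (^-monoˡ-≤ s₁ x≤m) (mˢ¹<xˢ L<x′ x′≤m)) 1≤j j≤s 1≤i i≤s)

  m∸L+size≤n∸1 : m ∸ L + size f n ≤ n ∸ 1
  m∸L+size≤n∸1 = injective-gaps⇒m∸L+size≤n∸1 IsPowerOf m f powers-injective gap-among-powers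

  upper-bound : ∀ {g} → size f n ≡ g → ∀ p q → (2 * q) ^ (s * s) < n * p ^ (s * s) →
    (q ∸ p) ^ s * n ≤ (q * (n ∸ g)) ^ s
  upper-bound {g} refl p q [2q]ˢˢ<npˢˢ = begin
    (q ∸ p) ^ s * n               ≤⟨ *-monoʳ-≤ ((q ∸ p) ^ s) (<⇒≤ (<-suc-root-^ s {n})) ⟩
    (q ∸ p) ^ s * suc m ^ s       ≡⟨ ^-distribʳ-* (q ∸ p) (suc m) s ⟨
    ((q ∸ p) * suc m) ^ s         ≤⟨ ^-monoˡ-≤ s [q∸p][1+m]≤q[n∸g] ⟩
    (q * (n ∸ g)) ^ s             ∎
    where
    open ≤-Reasoning
    1+m∸L≤n∸g : suc (m ∸ L) ≤ n ∸ g
    1+m∸L≤n∸g = m+n≤o⇒m≤o∸n (suc (m ∸ L))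
      (≤-trans (s≤s m∸L+size≤n∸1) (≤-reflexive (trans (+-comm 1 (n ∸ 1)) (m∸n+n≡m 1≤n))))
    qˢ≤[1+m]pˢ : q ^ s ≤ suc m * p ^ s
    qˢ≤[1+m]pˢ = ≤-trans (^-monoˡ-≤ s (m≤n*m q 2)) (<⇒≤ (^-cancelˡ-< s (begin-strict
      ((2 * q) ^ s) ^ s         ≡⟨ ^-*-assoc (2 * q) s s ⟩
      (2 * q) ^ (s * s)         <⟨ [2q]ˢˢ<npˢˢ ⟩
      n * p ^ (s * s)           ≤⟨ *-monoˡ-≤ (p ^ (s * s)) (<⇒≤ (<-suc-root-^ s {n})) ⟩
      suc m ^ s * p ^ (s * s)   ≡⟨ cong (suc m ^ s *_) (^-*-assoc p s s) ⟨
      suc m ^ s * (p ^ s) ^ s   ≡⟨ ^-distribʳ-* (suc m) (p ^ s) s ⟨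
      (suc m * p ^ s) ^ s       ∎)))
    qL≤p[1+m] : q * L ≤ p * suc m
    qL≤p[1+m] = ^-cancelˡ-≤ s (begin
      (q * L) ^ s                  ≡⟨ ^-distribʳ-* q L s ⟩
      q ^ s * L ^ s                ≤⟨ *-mono-≤ qˢ≤[1+m]pˢ (≤-trans (root-^-≤ s (m^n>0 m s₁)) (^-monoˡ-≤ s₁ (n≤1+n m))) ⟩
      suc m * p ^ s * suc m ^ s₁   ≡⟨ cong (_* suc m ^ s₁) (*-comm (suc m) (p ^ s)) ⟩
      p ^ s * suc m * suc m ^ s₁   ≡⟨ *-assoc (p ^ s) (suc m) _ ⟩
      p ^ s * suc m ^ s            ≡⟨ ^-distribʳ-* p (suc m) s ⟨
      (p * suc m) ^ s              ∎)
    [q∸p][1+m]≤q[n∸g] : (q ∸ p) * suc m ≤ q * (n ∸ g)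
    [q∸p][1+m]≤q[n∸g] = begin
      (q ∸ p) * suc m           ≡⟨ *-distribʳ-∸ (suc m) q p ⟩
      q * suc m ∸ p * suc m     ≤⟨ ∸-monoʳ-≤ (q * suc m) qL≤p[1+m] ⟩
      q * suc m ∸ q * L         ≡⟨ *-distribˡ-∸ q (suc m) L ⟨
      q * (suc m ∸ L)           ≤⟨ *-monoʳ-≤ q (≤-trans (∸-suc-≤ m L) 1+m∸L≤n∸g) ⟩
      q * (n ∸ g)               ∎

theorem1p1 : (k n s s' p q g : ℕ) →
    1 ≤ k → 1 ≤ n →
    IsSchurNumber k s → IsDoubleSchurNumber k s' → IsGStar k n g →
    1 ≤ p → 1 ≤ q →
    (2 * q) ^ (s * s) < n * p ^ (s * s) →
    (n ∸ g) ^ s' ≤ n × (q ∸ p) ^ s * n ≤ (q * (n ∸ g)) ^ s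
theorem1p1 (suc k) n zero _ _ _ _ _ _ (allSchur , _) _ _ _ _ _ = contradiction (allSchur⇒2≤ allSchur) λ ()
theorem1p1 (suc k) n (suc _) zero _ _ _ _ _ _ (allSchur' , _) _ _ _ _ = contradiction (allSchur'⇒2≤ allSchur') λ ()
theorem1p1 (suc k) n (suc s₁) (suc M) p q g _ 1≤n (allSchur , _) (allSchur' , minimal)
  isG@((_ , productFree , size≡g) , _) _ _ [2q]ˢˢ<npˢˢ
  with schurFree-colouring (minimal M ≤-refl)
... | c , no-sum , no-sum1 =
  LowerBound.lower-bound (s≤s⁻¹ (allSchur'⇒2≤ allSchur')) 1≤n c no-sum no-sum1 isG ,
  UpperBound.upper-bound 1≤n allSchur productFree size≡g p q [2q]ˢˢ<npˢˢ
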